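{- For any $k,h\in\mathbb{N}$ there exists a graph $G$ such that $G\notin\mathrm{TD}_k\mathrm{MW}_h$, but $G\in\mathrm{MTD}_3$.
   Context: Graphs are finite and simple. Operations: $\circ,\bullet$ return the empty and the one-vertex graph; $\mathrm{Union}_t$ ($t\ge2$) is disjoint union; $\mathrm{Join}_t$ is disjoint union plus all edges between different arguments; $\mathrm{Inc}_{x,E_x}(G)=(V\cup\{x\},E\cup E_x)$ for $G=(V,E)$, $x\notin V$, $E_x\subseteq\{\{x,v\}\mid v\in V\}$; $\mathrm{Subst}_H(G_1,\dots,G_t)$ for $V(H)=\{v_1,\dots,v_t\}$ replaces each $v_i$ by a disjoint copy of $G_i$ and adds all edges between $V(G_i)$ and $V(G_j)$ whenever $\{v_i,v_j\}\in E(H)$. A graph has an algebraic expression over a set of operations if it is (up to renaming) the value of it; the empty graph corresponds to the empty expression. The nesting depth of an operation is the maximum number of expression-tree nodes labelled by it on a root-to-leaf path. $\mathrm{td}(G)$ is the least $k$ such that $G$ has an expression over $\{\circ,\mathrm{Union}\}\cup\{\mathrm{Inc}_{x,E_x}\}$ with $\mathrm{Inc}$ nesting depth at most $k$. $\mathrm{MTD}_\ell$: graphs with an expression over $\{\bullet,\mathrm{Union},\mathrm{Join}\}\cup\{\mathrm{Subst}_H\mid\mathrm{td}(H)\le\ell\}$. $\mathrm{TD}_k\mathrm{MW}_h$: graphs with an expression over $\{\circ,\bullet,\mathrm{Union},\mathrm{Join}\}\cup\{\mathrm{Inc}_{x,E_x}\}\cup\{\mathrm{Subst}_H\mid|V(H)|\le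 h\}$ with $\mathrm{Inc}$ nesting depth at most $k$. -}

module Defs where

open import Data.Nat using (ℕ; zero; suc; _≤_)
open import Data.Fin using (Fin)
open import Data.Empty using (⊥)
open import Data.Unit using (⊤)
open import Data.Bool using (Bool; true; false; T)
open import Data.Maybe using (Maybe; just; nothing)
open import Data.Product using (Σ; _×_; _,_; ∃)
open import Data.Sum using (_⊎_)
open import Relation.Nullary using (¬_)
open import Relation.Binary.PropositionalEquality using (_≡_; _≢_; subst)
open import Function.Bundles using (_↔_; Inverse; _⇔_)
open import Level using (Lift) renaming (suc to lsuc; zero to lzero)
import Data.Empty.Polymorphic as P

record Graph : Set₁ where
  field
    V   : Set
    adj : V → V → Set
open Graph public

IsFiniteSimple : Graph → Set
IsFiniteSimple G =
  (∃ λ n → V G ↔ Fin n)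
  × (∀ u v → adj G u v → adj G v u)
  × (∀ v → ¬ adj G v v)

_≅_ : Graph → Graph → Set
G ≅ G' = Σ (V G ↔ V G') λ f →
  ∀ u v → adj G u v ⇔ adj G' (Inverse.to f u) (Inverse.to f v)

emptyG : Graph
emptyG = record { V = ⊥ ; adj = λ _ _ → ⊥ }

singleG : Graph
singleG = record { V = ⊤ ; adj = λ _ _ → ⊥ }

Subst : (H : Graph) → (V H → Graph) → Graph
Subst H Gs = record
  { V   = Σ (V H) (λ a → V (Gs a))
  ; adj = λ { (a , u) (b , w) →
            (Σ (a ≡ b) λ p → adj (Gs b) (subst (λ c → V (Gs c)) p u) w)
            ⊎ adj H a b } }

Edgeless : ℕ → Graph
Edgeless t = record { V = Fin t ; adj = λ _ _ → ⊥ }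

Complete : ℕ → Graph
Complete t = record { V = Fin t ; adj = λ i j → i ≢ j }

UnionG : (t : ℕ) → (Fin t → Graph) → Graph
UnionG t Gs = Subst (Edgeless t) Gs

JoinG : (t : ℕ) → (Fin t → Graph) → Graph
JoinG t Gs = Subst (Complete t) Gs

-- Inc_{x,E_x}(G): add a fresh vertex x (= nothing) adjacent to the set E
Inc : (G : Graph) → (V G → Set) → Graph
Inc G E = record { V = Maybe (V G) ; adj = a }
  where
  a : Maybe (V G) → Maybe (V G) → Set
  a nothing  nothing  = ⊥
  a nothing  (just v) = E v
  a (just v) nothing  = E v
  a (just u) (just v) = adj G u v

-- Flags: whether ∘ (empty) / • (single) / Join are allowed; SubstOK H says
-- whether Subst_H is allowed (Union is always allowed). The index d bounds
-- the nesting depth of Inc.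
data Gen (useEmpty useSingle useJoin : Bool) (SubstOK : Graph → Set₁)
         : ℕ → Graph → Set₁ where
  g-empty  : ∀ {d} → T useEmpty → Gen useEmpty useSingle useJoin SubstOK d emptyG
  g-single : ∀ {d} → T useSingle → Gen useEmpty useSingle useJoin SubstOK d singleG
  g-union  : ∀ {d} (t : ℕ) → 2 ≤ t → (Gs : Fin t → Graph) →
             (∀ i → Gen useEmpty useSingle useJoin SubstOK d (Gs i)) →
             Gen useEmpty useSingle useJoin SubstOK d (UnionG t Gs)
  g-join   : ∀ {d} → T useJoin → (t : ℕ) → 2 ≤ t → (Gs : Fin t → Graph) →
             (∀ i → Gen useEmpty useSingle useJoin SubstOK d (Gs i)) →
             Gen useEmpty useSingle useJoin SubstOK d (JoinG t Gs)
  g-inc    : ∀ {d} (G : Graph) → (E : V G → Set) →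
             Gen useEmpty useSingle useJoin SubstOK d G →
             Gen useEmpty useSingle useJoin SubstOK (suc d) (Inc G E)
  g-subst  : ∀ {d} (H : Graph) → SubstOK H → (Gs : V H → Graph) →
             (∀ v → Gen useEmpty useSingle useJoin SubstOK d (Gs v)) →
             Gen useEmpty useSingle useJoin SubstOK d (Subst H Gs)

-- G has an expression (up to renaming); the empty graph has the empty expression.
HasExpr : (useEmpty useSingle useJoin : Bool) → (Graph → Set₁) → ℕ → Graph → Set₁
HasExpr e s j S d G =
  (G ≅ emptyG) ⊎ Σ Graph (λ G' → Gen e s j S d G' × (G ≅ G'))

NoSubst : Graph → Set₁
NoSubst _ = P.⊥

-- td(H) ≤ ℓ : expression over {∘, Union, Inc} with Inc nesting depth ≤ ℓ
TDle : ℕ → Graph → Set₁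
TDle ℓ H = HasExpr true false false NoSubst ℓ H

-- MTD_ℓ : expressions over {•, Union, Join, Subst_H (td(H) ≤ ℓ)}, no Inc
MTD : ℕ → Graph → Set₁
MTD ℓ G = HasExpr false true true (TDle ℓ) 0 G

-- Subst_H allowed in TD_k MW_h : H a (finite simple) graph with |V(H)| ≤ h
SmallGraph : ℕ → Graph → Set₁
SmallGraph h H = Lift (lsuc lzero) (IsFiniteSimple H × (Σ ℕ λ m → m ≤ h × (V H ↔ Fin m)))

TDMW : ℕ → ℕ → Graph → Set₁
TDMW k h G = HasExpr true true true (SmallGraph h) k G

{-# OPTIONS --safe #-}

-- The witness is a lexicographic power S^(k+1) of the spider S with h + 2 legs of length 2;
-- td(S) ≤ 3, so every power of S lies in MTD₃. The blocks of a substitution are modules,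
-- and S is prime enough that a map on V(S) whose fibres are modules and which identifies
-- certain pairs of vertices is constant. Hence an induced copy of S^(d+1) in a Union, a Join
-- or a Subst_H with |V(H)| ≤ h lies in a single block (for Subst_H by pigeonhole on the
-- h + 2 inner vertices), and in Inc_{x,E_x}(G) some copy of S^d avoids x. By induction on
-- the expression, S^(k+1) has no expression of Inc-depth k.
module Submission where

open import Defs
open import Data.Nat using (ℕ; zero; suc; _+_; _*_; _^_; s≤s; z≤n)
open import Data.Nat.Properties using (m≤n⇒m≤1+n)
open import Data.Fin using (Fin; zero; suc; _≟_; punchIn)
open import Data.Fin.Properties using (0↔⊥; 1↔⊤; +↔⊎; *↔×; any?; pigeonhole; <⇒≢; punchInᵢ≢i)
open import Data.Empty using (⊥; ⊥-elim)
open import Data.Bool using (true; false)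
open import Data.Unit using (⊤; tt)
open import Data.Maybe using (Maybe; just; nothing; maybe′)
open import Data.Product using (Σ; _×_; _,_; ∃; proj₁; proj₂)
open import Data.Product.Function.NonDependent.Propositional using (_×-↔_)
open import Data.Sum using (_⊎_; inj₁; inj₂; [_,_]′)
open import Data.Sum.Function.Propositional using (_⊎-↔_)
open import Function using (_∘_; const)
open import Function.Bundles using (_↔_; Inverse; Injection; Equivalence; mk↔ₛ′; mk⇔)
open import Function.Properties.Inverse using (↔-refl; ↔-sym; ↔-trans; ↔⇒↣)
open import Level using (lift)
open import Relation.Nullary using (¬_; Dec; yes; no)
import Relation.Nullary.Decidable as Dec
open import Relation.Binary.PropositionalEquality

private
  variable
    X : Set
    A B G H : Graph
    m n : ℕ

Maybe↔⊤⊎ : Maybe X ↔ (⊤ ⊎ X)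
Maybe↔⊤⊎ = mk↔ₛ′ (maybe′ inj₂ (inj₁ tt)) [ const nothing , just ]′
  (λ { (inj₁ tt) → refl ; (inj₂ _) → refl })
  (λ { nothing → refl ; (just _) → refl })

Maybe↔Fin-suc : X ↔ Fin n → Maybe X ↔ Fin (suc n)
Maybe↔Fin-suc X↔Fin = ↔-trans Maybe↔⊤⊎ (↔-trans (↔-sym 1↔⊤ ⊎-↔ X↔Fin) (↔-sym +↔⊎))

×↔Fin-* : ∀ {Y : Set} → X ↔ Fin m → Y ↔ Fin n → (X × Y) ↔ Fin (m * n)
×↔Fin-* X↔Fin Y↔Fin = ↔-trans (X↔Fin ×-↔ Y↔Fin) (↔-sym *↔×)

finite-any? : {P : X → Set} → X ↔ Fin n → (∀ x → Dec (P x)) → Dec (∃ P)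
finite-any? {P = P} X↔Fin P? =
  Dec.map′ (λ (k , p) → from k , p)
           (λ (x , p) → to x , subst P (sym (strictlyInverseʳ x)) p)
           (any? (P? ∘ from))
  where open Inverse X↔Fin

nothing? : (x : Maybe X) → Dec (x ≡ nothing)
nothing? nothing  = yes refl
nothing? (just _) = no λ ()

just-unless-nothing : (x : Maybe X) → x ≢ nothing → ∃ λ y → x ≡ just y
just-unless-nothing nothing  x≢nothing = ⊥-elim (x≢nothing refl)
just-unless-nothing (just y) _         = y , refl

Undirected : Graph → Set
Undirected G = ∀ u v → adj G u v → adj G v u

Loopless : Graph → Set
Loopless G = ∀ v → ¬ adj G v v

Subst-undirected : ∀ H (Gs : V H → Graph) →
                   Undirected H → (∀ a → Undirected (Gs a)) → Undirected (Subst H Gs)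
Subst-undirected _ _ _  uGs (a , x) (_ , y) (inj₁ (refl , xy)) = inj₁ (refl , uGs a x y xy)
Subst-undirected _ _ uH _   (a , _) (b , _) (inj₂ ab)          = inj₂ (uH a b ab)

Subst-loopless : ∀ H (Gs : V H → Graph) →
                 Loopless H → (∀ a → Loopless (Gs a)) → Loopless (Subst H Gs)
Subst-loopless _ _ _  lGs (a , x) (inj₁ (refl , xx)) = lGs a x xx
Subst-loopless _ _ lH _   (a , _) (inj₂ aa)          = lH a aa

Inc-undirected : ∀ G (E : V G → Set) → Undirected G → Undirected (Inc G E)
Inc-undirected _ _ _  nothing  (just _) e  = e
Inc-undirected _ _ _  (just _) nothing  e  = e
Inc-undirected _ _ uG (just u) (just v) uv = uG u v uv

Inc-loopless : ∀ G (E : V G → Set) → Loopless G → Loopless (Inc G E)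
Inc-loopless _ _ lG (just v) vv = lG v vv

≅-refl : G ≅ G
≅-refl = ↔-refl , λ _ _ → mk⇔ (λ uv → uv) (λ uv → uv)

record _⊑_ (A G : Graph) : Set where
  field
    embed     : V A → V G
    injective : ∀ u v → embed u ≡ embed v → u ≡ v
    preserves : ∀ u v → adj A u v → adj G (embed u) (embed v)
    reflects  : ∀ u v → adj G (embed u) (embed v) → adj A u v
open _⊑_

⊑-trans : A ⊑ B → B ⊑ G → A ⊑ G
⊑-trans e f = record
  { embed     = embed f ∘ embed e
  ; injective = λ u v → injective e u v ∘ injective f _ _
  ; preserves = λ u v → preserves f _ _ ∘ preserves e u v
  ; reflects  = λ u v → reflects e u v ∘ reflects f _ _
  }

≅⇒⊑ : A ≅ G → A ⊑ G
≅⇒⊑ (A↔G , adj⇔) = record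
  { embed     = Inverse.to A↔G
  ; injective = λ _ _ → Injection.injective (↔⇒↣ A↔G)
  ; preserves = λ u v → Equivalence.to (adj⇔ u v)
  ; reflects  = λ u v → Equivalence.from (adj⇔ u v)
  }

module _ (H : Graph) (Gs : V H → Graph) where

  Subst-within-block : Loopless H → ∀ b x y → adj (Subst H Gs) (b , x) (b , y) → adj (Gs b) x y
  Subst-within-block _  _ _ _ (inj₁ (refl , xy)) = xy
  Subst-within-block lH b _ _ (inj₂ bb)          = ⊥-elim (lH b bb)

  Subst-pair-η : ∀ {b} (z : V (Subst H Gs)) (p : proj₁ z ≡ b) →
                 z ≡ (b , subst (V ∘ Gs) p (proj₂ z))
  Subst-pair-η _ refl = refl

  Subst-block-restriction : ∀ b → Loopless H → (e : A ⊑ Subst H Gs) →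
                            (∀ v → proj₁ (embed e v) ≡ b) → A ⊑ Gs b
  Subst-block-restriction {A = A} b lH e in-b = record
    { embed     = coordinate
    ; injective = λ u v cu≡cv →
        injective e u v (trans (η u) (trans (cong (b ,_) cu≡cv) (sym (η v))))
    ; preserves = λ u v uv → Subst-within-block lH b _ _
        (subst₂ (adj (Subst H Gs)) (η u) (η v) (preserves e u v uv))
    ; reflects  = λ u v cucv →
        reflects e u v (subst₂ (adj (Subst H Gs)) (sym (η u)) (sym (η v)) (inj₁ (refl , cucv)))
    }
    where
    coordinate : V A → V (Gs b)
    coordinate v = subst (V ∘ Gs) (in-b v) (proj₂ (embed e v))
    η : ∀ v → embed e v ≡ (b , coordinate v)
    η v = Subst-pair-η (embed e v) (in-b v)

Subst-section : ∀ H B → Loopless B → (r : V H → V B) → H ⊑ Subst H (const B)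
Subst-section _ _ lB r = record
  { embed     = λ q → q , r q
  ; injective = λ _ _ → cong proj₁
  ; preserves = λ _ _ → inj₂
  ; reflects  = λ { q _ (inj₁ (refl , loop)) → ⊥-elim (lB (r q) loop)
                  ; _ _ (inj₂ qq′) → qq′ }
  }

Subst-fibre : ∀ H B → Loopless H → (q : V H) → B ⊑ Subst H (const B)
Subst-fibre H B lH q = record
  { embed     = q ,_
  ; injective = λ _ _ → cong proj₂
  ; preserves = λ _ _ uv → inj₁ (refl , uv)
  ; reflects  = Subst-within-block H (const B) lH q
  }

Inc-restriction : ∀ {E} (e : A ⊑ Inc G E) → (∀ v → embed e v ≢ nothing) → A ⊑ G
Inc-restriction {A = A} {G = G} {E = E} e avoids = record
  { embed     = old
  ; injective = λ u v old-u≡old-v →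
      injective e u v (trans (η u) (trans (cong just old-u≡old-v) (sym (η v))))
  ; preserves = λ u v uv → subst₂ (adj (Inc G E)) (η u) (η v) (preserves e u v uv)
  ; reflects  = λ u v uv → reflects e u v (subst₂ (adj (Inc G E)) (sym (η u)) (sym (η v)) uv)
  }
  where
  old : V A → V G
  old v = proj₁ (just-unless-nothing (embed e v) (avoids v))
  η : ∀ v → embed e v ≡ just (old v)
  η v = proj₂ (just-unless-nothing (embed e v) (avoids v))

-- By injectivity at most one vertex is sent to the new vertex, so of two fibres one avoids it.
Inc-avoiding-fibre : ∀ H B {E} (p q : V H) → V B ↔ Fin n → p ≢ q →
                     (e : Subst H (const B) ⊑ Inc G E) → ∃ λ r → ∀ w → embed e (r , w) ≢ nothing
Inc-avoiding-fibre _ _ p q B↔Fin p≢q e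
  with finite-any? B↔Fin (λ w → nothing? (embed e (p , w)))
... | yes (_ , hit) = q , λ _ miss → p≢q (cong proj₁ (injective e _ _ (trans hit (sym miss))))
... | no none       = p , λ w hit → none (w , hit)

FibresAreModules : (G : Graph) → (V G → X) → Set
FibresAreModules G π = ∀ x y z → adj G x y → ¬ adj G x z → π y ≡ π z → π x ≡ π y

Subst-blocks-are-modules : ∀ H (Gs : V H → Graph) → FibresAreModules (Subst H Gs) proj₁
Subst-blocks-are-modules _ _ _ _ _ (inj₁ (x≡y , _)) _   _   = x≡y
Subst-blocks-are-modules H _ _ _ _ (inj₂ xy)        ¬xz y≡z =
  ⊥-elim (¬xz (inj₂ (subst (adj H _) y≡z xy)))

modules-pull-back : (e : A ⊑ G) {π : V G → X} →
                    FibresAreModules G π → FibresAreModules A (π ∘ embed e)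
modules-pull-back e mod x y z xy ¬xz = mod _ _ _ (preserves e x y xy) (¬xz ∘ reflects e x z)

blocks-pull-back : ∀ H (Gs : V H → Graph) (e : A ⊑ Subst H Gs) → FibresAreModules A (proj₁ ∘ embed e)
blocks-pull-back H Gs e = modules-pull-back e (Subst-blocks-are-modules H Gs)

Leg : Graph
Leg = Inc (Inc emptyG ⊥-elim) (const ⊤)

Spider : ℕ → Graph
Spider m = Inc (UnionG m (const Leg)) attach
  where
  attach : V (UnionG m (const Leg)) → Set
  attach (_ , nothing) = ⊤
  attach (_ , just _)  = ⊥

centre : V (Spider m)
centre = nothing

inner outer : Fin m → V (Spider m)
inner i = just (i , nothing)
outer i = just (i , just nothing)

legs-apart : ∀ {i j : Fin m} {x y} → i ≢ j → ¬ adj (Spider m) (just (i , x)) (just (j , y))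
legs-apart i≢j (inj₁ (i≡j , _)) = i≢j i≡j

Spider-undirected : ∀ m → Undirected (Spider m)
Spider-undirected m = Inc-undirected _ _ (Subst-undirected (Edgeless m) (const Leg) (λ _ _ ())
  (λ _ → Inc-undirected _ (const ⊤) (Inc-undirected emptyG ⊥-elim λ ())))

Spider-loopless : ∀ m → Loopless (Spider m)
Spider-loopless m = Inc-loopless _ _ (Subst-loopless (Edgeless m) (const Leg) (λ _ ())
  (λ _ → Inc-loopless _ (const ⊤) (Inc-loopless emptyG ⊥-elim λ ())))

Spider-finite : V (Spider m) ↔ Fin (suc (m * 2))
Spider-finite = Maybe↔Fin-suc (×↔Fin-* ↔-refl (Maybe↔Fin-suc (Maybe↔Fin-suc (↔-sym 0↔⊥))))

Spider-td : TDle 3 (Spider (2 + n))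
Spider-td = inj₂ (_ , g-inc _ _ (g-union _ (s≤s (s≤s z≤n)) _
                        (λ _ → g-inc _ _ (g-inc _ _ (g-empty tt)))) , ≅-refl)

module _ {π : V (Spider (2 + n)) → X} (mod : FibresAreModules (Spider (2 + n)) π) where

  outer-joins-centre : ∀ j → π centre ≡ π (inner j) → π centre ≡ π (outer j)
  outer-joins-centre j c≡a =
    trans c≡a (sym (mod (outer j) (inner j) centre (inj₁ (refl , tt)) (λ ()) (sym c≡a)))

  inner-joins-centre : ∀ {i j} → i ≢ j → π centre ≡ π (outer j) → π (inner i) ≡ π centre
  inner-joins-centre i≢j c≡b = mod (inner _) centre (outer _) tt (legs-apart i≢j) c≡b

  collapse-from-centre-outer : ∀ j → π centre ≡ π (outer j) → ∀ q → π q ≡ π centre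
  collapse-from-centre-outer j c≡bⱼ = collapse
    where
    k = punchIn j zero
    c≡bₖ : π centre ≡ π (outer k)
    c≡bₖ = outer-joins-centre k (sym (inner-joins-centre (punchInᵢ≢i j zero) c≡bⱼ))
    inner-joins : ∀ i → π (inner i) ≡ π centre
    inner-joins i with i ≟ j
    ... | yes refl = inner-joins-centre (≢-sym (punchInᵢ≢i j zero)) c≡bₖ
    ... | no i≢j   = inner-joins-centre i≢j c≡bⱼ
    collapse : ∀ q → π q ≡ π centre
    collapse nothing                   = refl
    collapse (just (i , nothing))      = inner-joins i
    collapse (just (i , just nothing)) = sym (outer-joins-centre i (sym (inner-joins i)))

  collapse-from-centre-inner : ∀ j → π centre ≡ π (inner j) → ∀ q → π q ≡ π centre
  collapse-from-centre-inner j = collapse-from-centre-outer j ∘ outer-joins-centre j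

  collapse-from-inner-pair : ∀ {i j} → i ≢ j → π (inner i) ≡ π (inner j) → ∀ q → π q ≡ π centre
  collapse-from-inner-pair {i} {j} i≢j aᵢ≡aⱼ = collapse-from-centre-inner j c≡aⱼ
    where
    bᵢ≡aᵢ : π (outer i) ≡ π (inner i)
    bᵢ≡aᵢ = mod (outer i) (inner i) (inner j) (inj₁ (refl , tt)) (legs-apart i≢j) aᵢ≡aⱼ
    c≡aⱼ : π centre ≡ π (inner j)
    c≡aⱼ = mod centre (inner j) (outer i) tt (λ ()) (sym (trans bᵢ≡aᵢ aᵢ≡aⱼ))

  collapse-from-outer-pair : ∀ {i j} → i ≢ j → π (outer i) ≡ π (outer j) → ∀ q → π q ≡ π centre
  collapse-from-outer-pair {i} {j} i≢j bᵢ≡bⱼ = collapse-from-centre-inner i c≡aᵢ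
    where
    aᵢ≡bᵢ : π (inner i) ≡ π (outer i)
    aᵢ≡bᵢ = mod (inner i) (outer i) (outer j) (inj₁ (refl , tt)) (legs-apart i≢j) bᵢ≡bⱼ
    c≡aᵢ : π centre ≡ π (inner i)
    c≡aᵢ = mod centre (inner i) (outer i) tt (λ ()) aᵢ≡bᵢ

LexPower : Graph → ℕ → Graph
LexPower H zero    = singleG
LexPower H (suc d) = Subst H (const (LexPower H d))

LexPower-point : ∀ H → V H → ∀ d → V (LexPower H d)
LexPower-point _ q zero    = tt
LexPower-point H q (suc d) = q , LexPower-point H q d

LexPower-undirected : ∀ H → Undirected H → ∀ d → Undirected (LexPower H d)
LexPower-undirected _ _ zero    _ _ ()
LexPower-undirected H uH (suc d) =
  Subst-undirected H (const (LexPower H d)) uH (λ _ → LexPower-undirected H uH d)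

LexPower-loopless : ∀ H → Loopless H → ∀ d → Loopless (LexPower H d)
LexPower-loopless _ _ zero    _ ()
LexPower-loopless H lH (suc d) =
  Subst-loopless H (const (LexPower H d)) lH (λ _ → LexPower-loopless H lH d)

LexPower-finite : V H ↔ Fin n → ∀ d → V (LexPower H d) ↔ Fin (n ^ d)
LexPower-finite H↔Fin zero    = ↔-sym 1↔⊤
LexPower-finite H↔Fin (suc d) = ×↔Fin-* H↔Fin (LexPower-finite H↔Fin d)

LexPower-MTD : ∀ {ℓ} → TDle ℓ H → ∀ d → MTD ℓ (LexPower H d)
LexPower-MTD {H = H} {ℓ} tdH d = inj₂ (_ , generated d , ≅-refl)
  where
  generated : ∀ d → Gen false true true (TDle ℓ) 0 (LexPower H d)
  generated zero    = g-single tt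
  generated (suc d) = g-subst _ tdH _ (λ _ → generated d)

module NoSmallExpression (h : ℕ) where

  S : Graph
  S = Spider (2 + h)

  SpiderConfined : (H : Graph) → (V H → Graph) → Set
  SpiderConfined H Gs = (e : S ⊑ Subst H Gs) → ∀ q → proj₁ (embed e q) ≡ proj₁ (embed e centre)

  Edgeless-confines : ∀ {t} (Gs : Fin t → Graph) → SpiderConfined (Edgeless t) Gs
  Edgeless-confines {t} Gs e with preserves e centre (inner zero) tt
  ... | inj₁ (c≡a , _) =
    collapse-from-centre-inner (blocks-pull-back (Edgeless t) Gs e) zero c≡a

  Complete-confines : ∀ {t} (Gs : Fin t → Graph) → SpiderConfined (Complete t) Gs
  Complete-confines {t} Gs e with proj₁ (embed e (outer zero)) ≟ proj₁ (embed e (outer (suc zero)))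
  ... | yes b₀≡b₁ =
    collapse-from-outer-pair (blocks-pull-back (Complete t) Gs e) (λ ()) b₀≡b₁
  ... | no  b₀≢b₁ = ⊥-elim (legs-apart (λ ()) (reflects e _ _ (inj₂ b₀≢b₁)))

  small-confines : ∀ H (Gs : V H → Graph) → SmallGraph h H → SpiderConfined H Gs
  small-confines H Gs (lift (_ , _ , m≤h , H↔Fin)) e
    with pigeonhole (s≤s (m≤n⇒m≤1+n m≤h)) (Inverse.to H↔Fin ∘ proj₁ ∘ embed e ∘ inner)
  ... | i , j , i<j , same =
    collapse-from-inner-pair (blocks-pull-back H Gs e) (<⇒≢ i<j) (Injection.injective (↔⇒↣ H↔Fin) same)

  module _ (H : Graph) (Gs : V H → Graph) (lH : Loopless H) (confined : SpiderConfined H Gs) where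

    -- Each section q ↦ (q , r q) is a copy of S, so it is confined; comparing two sections that
    -- differ only at the centre puts every vertex in the block of (centre , w).
    lex-confined : ∀ B → Loopless B → (e : Subst S (const B) ⊑ Subst H Gs) →
                   ∀ v w → proj₁ (embed e v) ≡ proj₁ (embed e (centre , w))
    lex-confined B lB e (q , u) w = via q
      where
      centredAt : V B → V B → V S → V B
      centredAt c _ nothing  = c
      centredAt _ o (just _) = o
      along : (r : V S → V B) →
              ∀ q → proj₁ (embed e (q , r q)) ≡ proj₁ (embed e (centre , r centre))
      along r = confined (⊑-trans (Subst-section S B lB r) e)
      via : ∀ q → proj₁ (embed e (q , u)) ≡ proj₁ (embed e (centre , w))
      via nothing  = trans (sym (along (centredAt u w) (inner zero))) (along (const w) (inner zero))
      via (just y) = along (centredAt w u) (just y)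

    confine : ∀ d (e : LexPower S (suc d) ⊑ Subst H Gs) →
              LexPower S (suc d) ⊑ Gs (proj₁ (embed e (centre , LexPower-point S centre d)))
    confine d e = Subst-block-restriction H Gs _ lH e λ v →
      lex-confined (LexPower S d) (LexPower-loopless S (Spider-loopless _) d) e v _

  no-embedding : ∀ {d G} → Gen true true true (SmallGraph h) d G → ¬ (LexPower S (suc d) ⊑ G)
  no-embedding {d} (g-empty _) e = embed e (centre , LexPower-point S centre d)
  no-embedding {d} (g-single _) e
    with injective e (centre , LexPower-point S centre d) (inner zero , LexPower-point S centre d) refl
  ... | ()
  no-embedding {d} (g-union t _ Gs gen) e =
    no-embedding (gen _) (confine (Edgeless t) Gs (λ _ ()) (Edgeless-confines Gs) d e)
  no-embedding {d} (g-join _ t _ Gs gen) e =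
    no-embedding (gen _) (confine (Complete t) Gs (λ _ i≢i → i≢i refl) (Complete-confines Gs) d e)
  no-embedding {d} (g-subst H small@(lift ((_ , _ , lH) , _)) Gs gen) e =
    no-embedding (gen _) (confine H Gs lH (small-confines H Gs small) d e)
  no-embedding {suc d} (g-inc _ _ gen) e
    with Inc-avoiding-fibre S (LexPower S (suc d)) centre (inner zero)
                            (LexPower-finite Spider-finite (suc d)) (λ ()) e
  ... | r , avoids = no-embedding gen (Inc-restriction (⊑-trans fibre e) avoids)
    where fibre = Subst-fibre S (LexPower S (suc d)) (Spider-loopless _) r

  not-TDMW : ∀ k → ¬ TDMW k h (LexPower S (suc k))
  not-TDMW k (inj₁ (V≅⊥ , _))     = Inverse.to V≅⊥ (centre , LexPower-point S centre k)
  not-TDMW k (inj₂ (_ , gen , iso)) = no-embedding gen (≅⇒⊑ iso)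

lemma29 : (k h : ℕ) → Σ Graph (λ G → IsFiniteSimple G × ¬ TDMW k h G × MTD 3 G)
lemma29 k h =
  LexPower S (suc k) ,
  ( (_ , LexPower-finite Spider-finite (suc k))
  , LexPower-undirected S (Spider-undirected _) (suc k)
  , LexPower-loopless S (Spider-loopless _) (suc k) ) ,
  not-TDMW k ,
  LexPower-MTD Spider-td (suc k)
  where open NoSmallExpression h
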